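{- Let $P$ be a finite poset with a free action of a finite group $\Gamma$, and let $k\ge0$. Then the induced $\Gamma$-action on the graph $(\mathrm{Chain}^k(P))^1$ is $2^k$-discontinuous.
   Context: For a poset $P$, $\mathrm{Chain}(P)$ is the poset of nonempty chains of $P$ ordered by inclusion; $\mathrm{Chain}^0(P)=P$ and $\mathrm{Chain}^{k+1}=\mathrm{Chain}(\mathrm{Chain}^k)$, with the induced $\Gamma$-actions. For a poset $Q$, $Q^1$ is the reflexive graph whose vertices are the atoms (minimal elements) of $Q$, with $x\sim y$ iff some $z\in Q$ satisfies $z\ge x$ and $z\ge y$. A left $\Gamma$-action on a graph is $d$-discontinuous ($d>0$) if for every vertex $v$ and every non-identity $\gamma\in\Gamma$, the vertex $\gamma v$ does not lie within graph distance $d-1$ of $v$. -}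

module Defs where

open import Level using (0ℓ)
open import Data.Nat using (ℕ; zero; suc; _≤_; _<_; _^_)
open import Data.Product using (Σ; _×_; ∃; _,_)
open import Data.List using (List; []; _∷_)
open import Data.List.Relation.Unary.All using (All)
open import Data.List.Relation.Unary.Any using (Any)
open import Data.List.Membership.Propositional using (_∈_)
open import Data.Unit using (⊤)
open import Data.Empty using (⊥)
open import Relation.Nullary using (¬_)
open import Relation.Binary.PropositionalEquality using (_≡_; _≢_)
open import Relation.Binary.Structures using (IsPartialOrder)
open import Algebra.Bundles using (Group)

record FinPoset : Set₁ where
  field
    Carrier   : Set
    _≤P_      : Carrier → Carrier → Set
    isPartialOrder : IsPartialOrder _≡_ _≤P_
    enum      : List Carrier
    complete  : ∀ x → x ∈ enum

IsFiniteGroup : Group 0ℓ 0ℓ → Set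
IsFiniteGroup Γ = Σ (List Carrier) λ gs → ∀ g → Any (g ≈_) gs
  where open Group Γ

record PosetAction (Γ : Group 0ℓ 0ℓ) (P : FinPoset) : Set where
  open Group Γ renaming (Carrier to G)
  open FinPoset P
  field
    act      : G → Carrier → Carrier
    act-cong : ∀ {g h} x → g ≈ h → act g x ≡ act h x
    act-ε    : ∀ x → act ε x ≡ x
    act-∙    : ∀ g h x → act (g ∙ h) x ≡ act g (act h x)
    act-mono : ∀ g {x y} → x ≤P y → act g x ≤P act g y

IsFree : ∀ {Γ P} → PosetAction Γ P → Set
IsFree {Γ} {P} A = ∀ g x → act g x ≡ x → g ≈ ε
  where open Group Γ
        open PosetAction A

-- An element of Chain(Q) is a nonempty finite chain of Q, represented
-- canonically by the list of its elements in strictly increasing order.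
-- Raw k : underlying (nested-list) representatives of elements of Chain^k(P);
-- Valid k : the predicate cutting out the actual elements.

module Chains (P : FinPoset) where
  open FinPoset P

  Raw : ℕ → Set
  Raw zero    = Carrier
  Raw (suc k) = List (Raw k)

  Le : ∀ k → Raw k → Raw k → Set
  Le zero    x y = x ≤P y
  Le (suc k) c d = All (λ x → x ∈ d) c

  Lt : ∀ k → Raw k → Raw k → Set
  Lt k x y = Le k x y × x ≢ y

  data Increasing (k : ℕ) : List (Raw k) → Set where
    inc[]  : Increasing k []
    inc[_] : ∀ x → Increasing k (x ∷ [])
    inc∷   : ∀ {x y xs} → Lt k x y → Increasing k (y ∷ xs) → Increasing k (x ∷ y ∷ xs)

  NonEmpty : ∀ {A : Set} → List A → Set
  NonEmpty []      = ⊥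
  NonEmpty (_ ∷ _) = ⊤

  Valid : ∀ k → Raw k → Set
  Valid zero    x = ⊤
  Valid (suc k) c = NonEmpty c × All (Valid k) c × Increasing k c

  IsAtom : ∀ k → Raw k → Set
  IsAtom k x = Valid k x × (∀ y → Valid k y → Le k y x → y ≡ x)

  Adj : ∀ k → Raw k → Raw k → Set
  Adj k x y = IsAtom k x × IsAtom k y × ∃ λ z → Valid k z × Le k x z × Le k y z

  data Walk (k : ℕ) : Raw k → Raw k → ℕ → Set where
    here : ∀ {x} → IsAtom k x → Walk k x x zero
    step : ∀ {x y z n} → Adj k x y → Walk k y z n → Walk k x z (suc n)

  WithinDist : ∀ k → ℕ → Raw k → Raw k → Set
  WithinDist k m x y = ∃ λ n → n ≤ m × Walk k x y n

module _ {Γ : Group 0ℓ 0ℓ} {P : FinPoset} (A : PosetAction Γ P) where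
  open Group Γ renaming (Carrier to G)
  open PosetAction A
  open Chains P

  actChain : ∀ k → G → Raw k → Raw k
  actChains : ∀ k → G → List (Raw k) → List (Raw k)
  actChain zero    g x = act g x
  actChain (suc k) g c = actChains k g c
  actChains k g []       = []
  actChains k g (x ∷ xs) = actChain k g x ∷ actChains k g xs

  IsDiscontinuous : ∀ k → (d : ℕ) → Set
  IsDiscontinuous k d = ∀ (v : Raw k) → IsAtom k v → ∀ (γ : G) → ¬ (γ ≈ ε) →
                        ∀ n → suc n ≡ d → ¬ WithinDist k n v (actChain k γ v)

-- Adjacent atoms of Chain^(k+1)(P) are singletons {a}, {b} with a, b comparable in
-- Chain^k(P), so it suffices to show that every comparability walk in Chain^k(P)
-- from x to γ x (γ ≠ 1) has length at least 2^(k+1). For k = 0 a walk of length 0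
-- or 1 would make x equal or comparable to γ x, and a free action on a finite poset
-- allows neither. For the step, follow a comparability walk of chains from x to γ x:
-- a suitable element e of one chain has, after m further steps, every element of the
-- current chain within distance ⌈(m+1)/2⌉, because a chain met after an ascent shares
-- an element with the previous one and a chain met after a descent is contained in
-- it. Choosing e at the start of the walk and trimming one step at each end yields
-- 2 · dist(e, γ e) ≤ n, so n ≥ 2 · 2^(k+1).
module Submission where

open import Defs
open import Level using (0ℓ)
open import Algebra.Bundles using (Group)
import Algebra.Properties.Group as GroupProperties
open import Data.Nat using (ℕ; zero; suc; _+_; _*_; _^_; _≤_; _<_; z≤n; s≤s; z<s; ⌊_/2⌋; ⌈_/2⌉)
open import Data.Nat.Properties
open import Data.Nat.GeneralisedArithmetic using (fold)
open import Data.Product using (Σ; ∃; ∃₂; _×_; _,_; proj₁; proj₂)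
open import Data.Sum using (_⊎_; inj₁; inj₂; map₂)
open import Data.List using (List; []; _∷_; map)
open import Data.List.Properties using (∷-injectiveˡ)
open import Data.List.Relation.Unary.All as All using (_∷_; [])
open import Data.List.Relation.Unary.Any using (here; there)
open import Data.List.Membership.Propositional using (_∈_)
open import Data.List.Membership.Propositional.Properties using (∈-map⁺; ∈-map⁻; finite)
open import Data.Unit using (tt)
open import Data.Empty using (⊥-elim)
open import Function.Base using (id)
open import Function.Bundles using (mk↣)
open import Relation.Nullary using (¬_)
open import Relation.Binary.Definitions using (tri<; tri≈; tri>)
open import Relation.Binary.PropositionalEquality using (_≡_; refl; sym; trans; cong; subst)
open import Relation.Binary.Structures using (IsPartialOrder)

module ComparabilityWalks (P : FinPoset) where
  open FinPoset P
  open Chains P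
  private module ≤P = IsPartialOrder isPartialOrder

  Le-refl : ∀ k {x} → Le k x x
  Le-refl zero    = ≤P.refl
  Le-refl (suc k) = All.tabulate id

  Le-trans : ∀ k {x y z} → Le k x y → Le k y z → Le k x z
  Le-trans zero    x≤y y≤z = ≤P.trans x≤y y≤z
  Le-trans (suc k) x⊆y y⊆z = All.map (All.lookup y⊆z) x⊆y

  Comparable : ∀ k → Raw k → Raw k → Set
  Comparable k x y = Le k x y ⊎ Le k y x

  Increasing-head≤ : ∀ {k x xs y} → Increasing k (x ∷ xs) → y ∈ xs → Le k x y
  Increasing-head≤     (inc∷ x<y _)    (here refl) = proj₁ x<y
  Increasing-head≤ {k} (inc∷ x<y rest) (there y∈) = Le-trans k (proj₁ x<y) (Increasing-head≤ rest y∈)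

  Increasing-tail : ∀ {k x xs} → Increasing k (x ∷ xs) → Increasing k xs
  Increasing-tail inc[ _ ]     = inc[]
  Increasing-tail (inc∷ _ rest) = rest

  Increasing⇒comparable : ∀ {k c e f} → Increasing k c → e ∈ c → f ∈ c → Comparable k e f
  Increasing⇒comparable {k} _   (here refl) (here refl) = inj₁ (Le-refl k)
  Increasing⇒comparable     inc (here refl) (there f∈)  = inj₁ (Increasing-head≤ inc f∈)
  Increasing⇒comparable     inc (there e∈)  (here refl) = inj₂ (Increasing-head≤ inc e∈)
  Increasing⇒comparable     inc (there e∈)  (there f∈)  = Increasing⇒comparable (Increasing-tail inc) e∈ f∈

  member-valid : ∀ {k c e} → Valid (suc k) c → e ∈ c → Valid k e
  member-valid (_ , valid , _) e∈c = All.lookup valid e∈c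

  some-member : ∀ {k c} → Valid (suc k) c → Σ (Raw k) (_∈ c)
  some-member {c = e ∷ _} _ = e , here refl

  members-comparable : ∀ {k c e f} → Valid (suc k) c → e ∈ c → f ∈ c → Comparable k e f
  members-comparable (_ , _ , inc) = Increasing⇒comparable inc

  data CompWalk (k : ℕ) : Raw k → Raw k → ℕ → Set where
    nil  : ∀ {x} → Valid k x → CompWalk k x x zero
    cons : ∀ {x y z n} → Valid k x → Comparable k x y → CompWalk k y z n → CompWalk k x z (suc n)

  CompWalk-start-valid : ∀ {k x y n} → CompWalk k x y n → Valid k x
  CompWalk-start-valid (nil vx)      = vx
  CompWalk-start-valid (cons vx _ _) = vx

  CompWalk-end-valid : ∀ {k x y n} → CompWalk k x y n → Valid k y
  CompWalk-end-valid (nil vy)     = vy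
  CompWalk-end-valid (cons _ _ w) = CompWalk-end-valid w

  CompWalk-snoc : ∀ {k x y z n} → CompWalk k x y n → Comparable k y z → Valid k z → CompWalk k x z (suc n)
  CompWalk-snoc (nil vx)      y~z vz = cons vx y~z (nil vz)
  CompWalk-snoc (cons vx c w) y~z vz = cons vx c (CompWalk-snoc w y~z vz)

  CompWalk-unsnoc : ∀ {k x z n} → CompWalk k x z (suc n) →
                    ∃ λ y → CompWalk k x y n × Comparable k y z
  CompWalk-unsnoc (cons vx x~z (nil _)) = _ , nil vx , x~z
  CompWalk-unsnoc (cons vx c w@(cons _ _ _)) =
    let y , w′ , y~z = CompWalk-unsnoc w in y , cons vx c w′ , y~z

  CompWithin : ∀ k → ℕ → Raw k → Raw k → Set
  CompWithin k j e f = ∃ λ l → l ≤ j × CompWalk k e f l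

  CompWithin-mono : ∀ {k i j e f} → i ≤ j → CompWithin k i e f → CompWithin k j e f
  CompWithin-mono i≤j (l , l≤i , w) = l , ≤-trans l≤i i≤j , w

  CompWithin-snoc : ∀ {k j e f g} → CompWithin k j e f → Comparable k f g → Valid k g →
                    CompWithin k (suc j) e g
  CompWithin-snoc (l , l≤j , w) f~g vg = suc l , s≤s l≤j , CompWalk-snoc w f~g vg

  -- The invariant carried along a walk of chains: x meets the ball of radius ⌊s/2⌋
  -- around e and lies inside the ball of radius ⌈s/2⌉.
  Reach : ∀ k → Raw k → Raw (suc k) → ℕ → Set
  Reach k e x s = (∃ λ f → f ∈ x × CompWithin k ⌊ s /2⌋ e f)
                × (∀ {f} → f ∈ x → CompWithin k ⌈ s /2⌉ e f)

  reach-start : ∀ {k e x} → Valid (suc k) x → e ∈ x → Reach k e x 1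
  reach-start vx e∈x =
    (_ , e∈x , 0 , z≤n , nil (member-valid vx e∈x)) ,
    λ f∈x → 1 , ≤-refl ,
            cons (member-valid vx e∈x) (members-comparable vx e∈x f∈x) (nil (member-valid vx f∈x))

  reach-step : ∀ {k e x y s} → Valid (suc k) y → Comparable (suc k) x y →
               Reach k e x s → Reach k e y (suc s)
  reach-step {s = s} vy (inj₁ x⊆y) ((f , f∈x , near) , _) =
    (f , f∈y , CompWithin-mono (⌊n/2⌋-mono (n≤1+n s)) near) ,
    λ g∈y → CompWithin-snoc near (members-comparable vy f∈y g∈y) (member-valid vy g∈y)
    where f∈y = All.lookup x⊆y f∈x
  reach-step {s = s} vy (inj₂ y⊆x) (_ , inside) =
    (f , f∈y , inside (All.lookup y⊆x f∈y)) ,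
    λ g∈y → CompWithin-mono (⌈n/2⌉-mono (n≤1+n s)) (inside (All.lookup y⊆x g∈y))
    where f   = proj₁ (some-member vy)
          f∈y = proj₂ (some-member vy)

  reach-walk : ∀ {k e x y s m} → Reach k e x s → CompWalk (suc k) x y m → Reach k e y (s + m)
  reach-walk {k} {e} {y = y} {s} r (nil _) = subst (Reach k e y) (sym (+-identityʳ s)) r
  reach-walk {k} {e} {y = y} {s} r (cons {n = m} _ x~x₁ w) =
    subst (Reach k e y) (sym (+-suc s m)) (reach-walk (reach-step (CompWalk-start-valid w) x~x₁ r) w)

  spread : ∀ {k e x y f m} → e ∈ x → CompWalk (suc k) x y m → f ∈ y → CompWithin k ⌈ suc m /2⌉ e f
  spread e∈x w = proj₂ (reach-walk (reach-start (CompWalk-start-valid w) e∈x) w)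

  atom-singleton : ∀ {k x} → IsAtom (suc k) x → ∃ λ a → x ≡ a ∷ [] × Valid k a
  atom-singleton {x = a ∷ _} ((_ , va ∷ _ , _) , minimal) =
    a , sym (minimal (a ∷ []) (tt , va ∷ [] , inc[ a ]) (here refl ∷ [])) , va

  Walk⇒CompWalk : ∀ {k x y n} → Walk (suc k) x y n →
                  ∃₂ λ a b → x ≡ a ∷ [] × y ≡ b ∷ [] × CompWalk k a b n
  Walk⇒CompWalk (here atom) with atom-singleton atom
  ... | a , refl , va = a , a , refl , refl , nil va
  Walk⇒CompWalk (step (atom , _ , z , vz , x⊆z , y⊆z) w)
    with atom-singleton atom | Walk⇒CompWalk w
  ... | a , refl , va | a′ , b , refl , refl , w′ =
    a , b , refl , refl ,
    cons va (members-comparable vz (All.lookup x⊆z (here refl)) (All.lookup y⊆z (here refl))) w′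

  Walk-zero⇒≡ : ∀ {k x y} → Walk k x y zero → x ≡ y
  Walk-zero⇒≡ (here _) = refl

module Anchoring {Γ : Group 0ℓ 0ℓ} {P : FinPoset} (A : PosetAction Γ P) where
  open Group Γ using () renaming (Carrier to G)
  open Chains P
  open ComparabilityWalks P

  actChains≡map : ∀ k g c → actChains A k g c ≡ map (actChain A k g) c
  actChains≡map k g []      = refl
  actChains≡map k g (e ∷ c) = cong (actChain A k g e ∷_) (actChains≡map k g c)

  ∈-actChains⁺ : ∀ {k g e c} → e ∈ c → actChain A k g e ∈ actChains A k g c
  ∈-actChains⁺ {k} {g} {c = c} e∈c =
    subst (_ ∈_) (sym (actChains≡map k g c)) (∈-map⁺ (actChain A k g) e∈c)

  ∈-actChains⁻ : ∀ {k g f c} → f ∈ actChains A k g c → ∃ λ e → e ∈ c × f ≡ actChain A k g e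
  ∈-actChains⁻ {k} {g} {c = c} f∈ = ∈-map⁻ (actChain A k g) (subst (_ ∈_) (actChains≡map k g c) f∈)

  -- An element whose translate lies on a shortened walk, so that `spread` applies;
  -- `length ≡ 0` covers the walks of length below 2, where e and γ e share a chain.
  record Anchor (k : ℕ) (g : G) (n : ℕ) : Set where
    constructor anchor
    field
      {point}     : Raw k
      {start end} : Raw (suc k)
      {length}    : ℕ
      point∈start : point ∈ start
      image∈end   : actChain A k g point ∈ end
      walk        : CompWalk (suc k) start end length
      short       : length ≡ 0 ⊎ 2 + length ≤ n

  Anchor-mono : ∀ {k g n n′} → n ≤ n′ → Anchor k g n → Anchor k g n′
  Anchor-mono n≤n′ (anchor e∈ γe∈ w short) =
    anchor e∈ γe∈ w (map₂ (λ h → ≤-trans h n≤n′) short)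

  anchor-below : ∀ {k g x u y m} → Valid (suc k) x → Le (suc k) u x → CompWalk (suc k) u y m →
                 y ≡ actChain A (suc k) g x → Anchor k g (suc m)
  anchor-below vx u⊆x (nil vu) refl with some-member vu
  ... | f , f∈γx with ∈-actChains⁻ f∈γx
  ... | e , e∈x , refl = anchor e∈x (All.lookup u⊆x f∈γx) (nil vx) (inj₁ refl)
  anchor-below {k} vx u⊆x (cons _ (inj₂ v⊆u) w) eq =
    Anchor-mono (n≤1+n _) (anchor-below vx (Le-trans (suc k) v⊆u u⊆x) w eq)
  anchor-below vx u⊆x (cons vu (inj₁ u⊆v) w) refl with some-member vu
  ... | e , e∈u = anchor (All.lookup u⊆v e∈u) (∈-actChains⁺ (All.lookup u⊆x e∈u)) w (inj₂ ≤-refl)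

  anchor-walk : ∀ {k g x y n} → CompWalk (suc k) x y n → y ≡ actChain A (suc k) g x → Anchor k g n
  anchor-walk (nil vx) x≡γx with some-member vx
  ... | e , e∈x = anchor e∈x (subst (_ ∈_) (sym x≡γx) (∈-actChains⁺ e∈x)) (nil vx) (inj₁ refl)
  anchor-walk (cons vx (inj₂ x₁⊆x) w) eq = anchor-below vx x₁⊆x w eq
  anchor-walk (cons vx (inj₁ x⊆x₁) (nil vx₁)) refl with some-member vx
  ... | e , e∈x = anchor (All.lookup x⊆x₁ e∈x) (∈-actChains⁺ e∈x) (nil vx₁) (inj₁ refl)
  anchor-walk (cons vx (inj₁ x⊆x₁) w@(cons _ _ _)) refl with CompWalk-unsnoc w
  ... | z , w′ , inj₂ γx⊆z with some-member vx
  ...   | e , e∈x = anchor (All.lookup x⊆x₁ e∈x) (All.lookup γx⊆z (∈-actChains⁺ e∈x)) w′ (inj₂ ≤-refl)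
  anchor-walk (cons vx (inj₁ x⊆x₁) w@(cons _ _ _)) refl | z , w′ , inj₁ z⊆γx
    with some-member (CompWalk-end-valid w′)
  ... | f , f∈z with ∈-actChains⁻ (All.lookup z⊆γx f∈z)
  ...   | e , e∈x , refl = anchor (All.lookup x⊆x₁ e∈x) f∈z w′ (inj₂ ≤-refl)

module FreeAction {Γ : Group 0ℓ 0ℓ} {P : FinPoset} (A : PosetAction Γ P) (free : IsFree A) where
  open Group Γ using (_≈_; ε; _⁻¹; inverseˡ) renaming (Carrier to G)
  open GroupProperties Γ using (⁻¹-injective; ε⁻¹≈ε)
  open PosetAction A
  open FinPoset P
  open Chains P
  open ComparabilityWalks P
  open Anchoring A
  private module ≤P = IsPartialOrder isPartialOrder

  act-⁻¹-cancel : ∀ g x → act (g ⁻¹) (act g x) ≡ x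
  act-⁻¹-cancel g x = trans (sym (act-∙ (g ⁻¹) g x)) (trans (act-cong x (inverseˡ g)) (act-ε x))

  act-injective : ∀ g {x y} → act g x ≡ act g y → x ≡ y
  act-injective g {x} {y} eq =
    trans (sym (act-⁻¹-cancel g x)) (trans (cong (act (g ⁻¹)) eq) (act-⁻¹-cancel g y))

  module Orbit (g : G) (g≉ε : ¬ g ≈ ε) {x : Carrier} (x≤gx : x ≤P act g x) where
    orbit : ℕ → Carrier
    orbit = fold x (act g)

    x≤orbit : ∀ n → x ≤P orbit n
    x≤orbit zero    = ≤P.refl
    x≤orbit (suc n) = ≤P.trans x≤gx (act-mono g (x≤orbit n))

    orbit-mono : ∀ {m n} → m ≤ n → orbit m ≤P orbit n
    orbit-mono {n = n} z≤n = x≤orbit n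
    orbit-mono (s≤s m≤n)   = act-mono g (orbit-mono m≤n)

    orbit-cancel : ∀ i {d} → orbit i ≡ orbit (i + d) → x ≡ orbit d
    orbit-cancel zero    eq = eq
    orbit-cancel (suc i) eq = orbit-cancel i (act-injective g eq)

    -- A return x = g^(d+1) x squeezes g x ≤ g^(d+1) x = x ≤ g x.
    orbit-no-return : ∀ d → ¬ x ≡ orbit (suc d)
    orbit-no-return d x≡ = g≉ε (free g x (≤P.antisym gx≤x x≤gx))
      where gx≤x = subst (act g x ≤P_) (sym x≡) (orbit-mono {1} {suc d} (s≤s z≤n))

    orbit-no-repeat : ∀ {i j} → i < j → ¬ orbit i ≡ orbit j
    orbit-no-repeat {i} i<j eq with m≤n⇒∃[o]m+o≡n i<j
    ... | d , refl = orbit-no-return d (orbit-cancel i (trans eq (cong orbit (sym (+-suc i d)))))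

    orbit-injective : ∀ {i j} → orbit i ≡ orbit j → i ≡ j
    orbit-injective {i} {j} eq with <-cmp i j
    ... | tri< i<j _ _ = ⊥-elim (orbit-no-repeat i<j eq)
    ... | tri≈ _ i≡j _ = i≡j
    ... | tri> _ _ j<i = ⊥-elim (orbit-no-repeat j<i (sym eq))

  not-below-translate : ∀ {g} → ¬ g ≈ ε → ∀ x → ¬ x ≤P act g x
  not-below-translate g≉ε x x≤gx = finite (mk↣ orbit-injective) enum (λ i → complete (orbit i))
    where open Orbit _ g≉ε x≤gx

  translate-incomparable : ∀ {g} → ¬ g ≈ ε → ∀ x → ¬ Comparable 0 x (act g x)
  translate-incomparable g≉ε x (inj₁ x≤gx) = not-below-translate g≉ε x x≤gx
  translate-incomparable {g} g≉ε x (inj₂ gx≤x) =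
    not-below-translate g⁻¹≉ε x (subst (_≤P act (g ⁻¹) x) (act-⁻¹-cancel g x) (act-mono (g ⁻¹) gx≤x))
    where g⁻¹≉ε = λ g⁻¹≈ε → g≉ε (⁻¹-injective (Group.trans Γ g⁻¹≈ε (Group.sym Γ ε⁻¹≈ε)))

  ⌊n/2⌋-double≤ : ∀ n → 2 * ⌊ n /2⌋ ≤ n
  ⌊n/2⌋-double≤ n = begin
    2 * ⌊ n /2⌋        ≡⟨ cong (⌊ n /2⌋ +_) (+-identityʳ ⌊ n /2⌋) ⟩
    ⌊ n /2⌋ + ⌊ n /2⌋  ≤⟨ +-monoʳ-≤ ⌊ n /2⌋ (⌊n/2⌋≤⌈n/2⌉ n) ⟩
    ⌊ n /2⌋ + ⌈ n /2⌉  ≡⟨ ⌊n/2⌋+⌈n/2⌉≡n n ⟩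
    n                  ∎
    where open ≤-Reasoning

  radius-doubles : ∀ k {m n} → 2 ^ suc k ≤ ⌈ suc m /2⌉ → m ≡ 0 ⊎ 2 + m ≤ n → 2 ^ suc (suc k) ≤ n
  radius-doubles k h (inj₁ refl) = ⊥-elim (<⇒≱ (^-monoʳ-< 2 (s≤s (s≤s z≤n)) {0} {suc k} z<s) h)
  radius-doubles k {m} {n} h (inj₂ 2+m≤n) = begin
    2 * 2 ^ suc k           ≤⟨ *-monoʳ-≤ 2 h ⟩
    2 * suc ⌊ m /2⌋         ≡⟨ *-suc 2 ⌊ m /2⌋ ⟩
    2 + 2 * ⌊ m /2⌋         ≤⟨ +-monoʳ-≤ 2 (⌊n/2⌋-double≤ m) ⟩
    2 + m                   ≤⟨ 2+m≤n ⟩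
    n                       ∎
    where open ≤-Reasoning

  translate-distance : ∀ k {g} → ¬ g ≈ ε → ∀ {x y n} →
                       CompWalk k x y n → y ≡ actChain A k g x → 2 ^ suc k ≤ n
  translate-distance zero g≉ε (nil _) x≡gx = ⊥-elim (g≉ε (free _ _ (sym x≡gx)))
  translate-distance zero g≉ε (cons _ x~gx (nil _)) refl = ⊥-elim (translate-incomparable g≉ε _ x~gx)
  translate-distance zero g≉ε (cons _ _ (cons _ _ _)) _ = s≤s (s≤s z≤n)
  translate-distance (suc k) g≉ε w eq with anchor-walk w eq
  ... | anchor e∈start γe∈end w′ short with spread e∈start w′ γe∈end
  ...   | l , l≤radius , w″ =
    radius-doubles k (≤-trans (translate-distance k g≉ε w″ refl) l≤radius) short

lemma6p13 : (Γ : Group 0ℓ 0ℓ) → IsFiniteGroup Γ → (P : FinPoset) →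
            (A : PosetAction Γ P) → IsFree A →
            (k : ℕ) → IsDiscontinuous A k (2 ^ k)
lemma6p13 Γ _ P A free zero v _ γ γ≉ε .zero refl (.zero , z≤n , w) =
  γ≉ε (free γ v (sym (ComparabilityWalks.Walk-zero⇒≡ P w)))
lemma6p13 Γ _ P A free (suc k) v _ γ γ≉ε n 1+n≡2^k (l , l≤n , w)
  with a , b , refl , γa≡b , w′ ← ComparabilityWalks.Walk⇒CompWalk P w =
  <⇒≱ (≤-trans (s≤s l≤n) (≤-reflexive 1+n≡2^k))
      (FreeAction.translate-distance A free k γ≉ε w′ (sym (∷-injectiveˡ γa≡b)))
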